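{- Let $t$ be a positive integer. For all graphs $H_1,H_2$ with treewidth at most $t$, the graph $G:=H_1\boxtimes H_2$ has a $2$-colouring with clustering at most $2((t+1)|V(G)|)^{2/3}$.
   Context: All graphs are finite and simple. A colouring of a graph assigns a colour to each vertex (adjacent vertices may receive the same colour); a $c$-colouring uses at most $c$ colours. A monochromatic component is a connected component of the subgraph induced by the vertices of one colour. A colouring has clustering at most $k$ if every monochromatic component has at most $k$ vertices. The strong product $G\boxtimes H$ has vertex set $V(G)\times V(H)$, with distinct $(u,v),(u',v')$ adjacent iff ($u=u'$ and $vv'\in E(H)$) or ($v=v'$ and $uu'\in E(G)$) or ($uu'\in E(G)$ and $vv'\in E(H)$). -}

module Defs where

open import Data.Nat using (ℕ; zero; suc; _+_; _*_; _≤_)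
open import Data.Fin using (Fin; remQuot)
open import Data.Fin.Subset using (Subset; _∈_; ∣_∣)
open import Data.Product using (_×_; _,_; proj₁; proj₂; ∃; Σ-syntax)
open import Data.Sum using (_⊎_)
open import Data.Unit using (⊤)
open import Data.Empty using (⊥)
open import Function.Definitions using (Injective)
open import Relation.Nullary using (¬_; Dec)
open import Relation.Binary.PropositionalEquality using (_≡_; _≢_)

record Graph : Set₁ where
  field
    n     : ℕ
    Adj   : Fin n → Fin n → Set
    adj?  : ∀ u v → Dec (Adj u v)
    adj-sym : ∀ {u v} → Adj u v → Adj v u
    irrefl : ∀ {u} → ¬ Adj u u
open Graph public

data Walk (G : Graph) (P : Fin (n G) → Set) : Fin (n G) → Fin (n G) → Set where
  [_] : ∀ {u} → P u → Walk G P u u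
  _∷⟨_⟩_ : ∀ {u v w} → P u → Adj G u v → Walk G P v w → Walk G P u w

Connected : Graph → Set
Connected G = ∀ u v → Walk G (λ _ → ⊤) u v

-- A cycle of length k+3: an injective cyclic sequence of vertices with consecutive ones adjacent.
next : ∀ {k} → Fin (suc k) → Fin (suc k)
next {k} i = Data.Fin.fromℕ< {(suc (Data.Fin.toℕ i)) Data.Nat.% (suc k)} (Data.Nat.DivMod.m%n<n (suc (Data.Fin.toℕ i)) (suc k))
  where import Data.Nat.DivMod

HasCycle : Graph → Set
HasCycle G = Σ[ k ∈ ℕ ] Σ[ f ∈ (Fin (suc (suc (suc k))) → Fin (n G)) ]
               (Injective _≡_ _≡_ f × (∀ i → Adj G (f i) (f (next i))))

IsTree : Graph → Set
IsTree T = (1 ≤ n T) × Connected T × ¬ HasCycle T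

record TreeDecomposition (G : Graph) (t : ℕ) : Set₁ where
  field
    T      : Graph
    isTree : IsTree T
    bag    : Fin (n T) → Subset (n G)
    vertexCovered : ∀ v → ∃ λ x → v ∈ bag x
    edgeCovered   : ∀ u v → Adj G u v → ∃ λ x → (u ∈ bag x × v ∈ bag x)
    subtree : ∀ v x y → v ∈ bag x → v ∈ bag y → Walk T (λ z → v ∈ bag z) x y
    width  : ∀ x → ∣ bag x ∣ ≤ suc t

TreewidthAtMost : Graph → ℕ → Set₁
TreewidthAtMost G t = TreeDecomposition G t

-- Strong product; vertex i of Fin (n₁ * n₂) corresponds to the pair remQuot n₂ i.
_⊠_ : Graph → Graph → Graph
G ⊠ H = record
  { n = n G * n H
  ; Adj = λ i j → SAdj (remQuot (n H) i) (remQuot (n H) j)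
  ; adj? = λ i j → sadj? (remQuot (n H) i) (remQuot (n H) j)
  ; adj-sym = λ {i} {j} → ssym (remQuot (n H) i) (remQuot (n H) j)
  ; irrefl = λ {i} → sirr (remQuot (n H) i)
  }
  where
  open import Relation.Nullary using (yes; no)
  open import Relation.Nullary.Decidable using (_×-dec_; _⊎-dec_)
  open import Data.Fin using (_≟_)
  open import Relation.Binary.PropositionalEquality renaming (sym to ≡-sym)
  SAdj : Fin (n G) × Fin (n H) → Fin (n G) × Fin (n H) → Set
  SAdj (u , v) (u' , v') = (u ≡ u' × Adj H v v') ⊎ (v ≡ v' × Adj G u u') ⊎ (Adj G u u' × Adj H v v')
  sadj? : ∀ p q → Dec (SAdj p q)
  sadj? (u , v) (u' , v') = ((u ≟ u') ×-dec adj? H v v') ⊎-dec (((v ≟ v') ×-dec adj? G u u') ⊎-dec (adj? G u u' ×-dec adj? H v v'))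
  ssym : ∀ p q → SAdj p q → SAdj q p
  ssym _ _ (Data.Sum.inj₁ (e , a)) = Data.Sum.inj₁ (≡-sym e , Graph.adj-sym H a)
  ssym _ _ (Data.Sum.inj₂ (Data.Sum.inj₁ (e , a))) = Data.Sum.inj₂ (Data.Sum.inj₁ (≡-sym e , Graph.adj-sym G a))
  ssym _ _ (Data.Sum.inj₂ (Data.Sum.inj₂ (a , b))) = Data.Sum.inj₂ (Data.Sum.inj₂ (Graph.adj-sym G a , Graph.adj-sym H b))
  sirr : ∀ p → ¬ SAdj p p
  sirr _ (Data.Sum.inj₁ (_ , a)) = irrefl H a
  sirr _ (Data.Sum.inj₂ (Data.Sum.inj₁ (_ , a))) = irrefl G a
  sirr _ (Data.Sum.inj₂ (Data.Sum.inj₂ (a , _))) = irrefl G a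

Colouring : Graph → ℕ → Set
Colouring G c = Fin (n G) → Fin c

InOneMonoComponent : (G : Graph) {c : ℕ} → Colouring G c → Subset (n G) → Set
InOneMonoComponent G col S =
  ∀ u v → u ∈ S → v ∈ S → Walk G (λ w → col w ≡ col u) u v

ClusteringAtMost : (G : Graph) {c : ℕ} → Colouring G c → ℕ → Set
ClusteringAtMost G col k = ∀ S → InOneMonoComponent G col S → ∣ S ∣ ≤ k

-- Let P = (t+1)|V(G)| and m = ⌊P^(1/3)⌋. A graph H of treewidth at most t has a set X of at most
-- (t+1)|V(H)|/(m+1) vertices whose removal leaves only components of at most m vertices: root a tree
-- decomposition and, working up from the leaves, cut every node whose not-yet-separated subtree
-- carries more than m vertices; X is the union of the cut bags. Take such X₁ ⊆ V(H₁), X₂ ⊆ V(H₂) and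
-- give (a , b) the first colour iff a ∈ X₁ or b ∈ X₂. The first colour class has at most
-- |V(H₂)||X₁| + |V(H₁)||X₂| ≤ 2P/(m+1) vertices. A component of the second colour projects into a
-- component of H₁ − X₁ and into one of H₂ − X₂, so it has at most m² vertices. Either bound gives
-- |S|³ ≤ 8P².

module Submission where

open import Defs
open import Data.Nat using (ℕ; zero; suc; _+_; _*_; _∸_; _^_; _%_; _≤_; _<_; z≤n; s≤s; _≟_; _≤?_; _<?_)
open import Data.Nat.DivMod using (m<n⇒m%n≡m; n%n≡0)
open import Data.Nat.Properties
open import Data.Fin using (Fin; zero; suc; toℕ; fromℕ; fromℕ<; inject₁; _↑ˡ_; _↑ʳ_; remQuot)
open import Data.Fin.Properties
  using (splitAt-↑ˡ; splitAt-↑ʳ; any?; toℕ-injective; toℕ-fromℕ<; toℕ-fromℕ; toℕ-inject₁; toℕ<n)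
  renaming (suc-injective to Fin-suc-injective; _≟_ to _≟ᶠ_)
open import Data.Fin.Subset using (Subset; inside; outside; ∣_∣) renaming (_∈_ to _∈ˢ_)
open import Data.Fin.Subset.Properties using (_∈?_; nonempty?; Empty-unique; ∣⊥∣≡0)
open import Data.Vec.Base using ([]; _∷_; there)
open import Data.Product using (_×_; _,_; proj₁; proj₂; ∃; ∃-syntax; Σ-syntax)
open import Data.Sum using (_⊎_; inj₁; inj₂; [_,_]′)
open import Data.Unit using (⊤; tt)
open import Data.Empty using (⊥-elim)
open import Function using (_∘_)
open import Relation.Nullary using (¬_; Dec; yes; no)
open import Relation.Nullary.Decidable using (_×-dec_; _⊎-dec_; ¬?)
open import Relation.Unary using (Decidable)
open import Relation.Binary.PropositionalEquality
open import Data.Nat.Solver using (module +-*-Solver)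
open +-*-Solver using (solve; _:+_; _:*_; _:^_; _:=_; con)
open import Algebra.Properties.CommutativeSemigroup *-commutativeSemigroup using (x∙yz≈y∙xz)
open import Algebra.Properties.Semiring.Sum +-*-semiring
  using (sum; sum-syntax; sum-cong-≗; sum-replicate-zero; ∑-distrib-+; ∑-comm; *-distribˡ-sum; *-distribʳ-sum)

-- Finite sums and counting

sum-mono-≤ : ∀ {k} {f g : Fin k → ℕ} → (∀ i → f i ≤ g i) → sum f ≤ sum g
sum-mono-≤ {zero}  f≤g = z≤n
sum-mono-≤ {suc k} f≤g = +-mono-≤ (f≤g zero) (sum-mono-≤ (f≤g ∘ suc))

term≤sum : ∀ {k} (f : Fin k → ℕ) i → f i ≤ sum f
term≤sum f zero    = m≤m+n (f zero) _
term≤sum f (suc i) = ≤-trans (term≤sum (f ∘ suc) i) (m≤n+m _ (f zero))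

sum-const : ∀ k c → ∑[ i < k ] c ≡ k * c
sum-const zero    c = refl
sum-const (suc k) c = cong (c +_) (sum-const k c)

∑-+-split : ∀ a b (f : Fin (a + b) → ℕ) → sum f ≡ ∑[ i < a ] f (i ↑ˡ b) + ∑[ j < b ] f (a ↑ʳ j)
∑-+-split zero    b f = refl
∑-+-split (suc a) b f = trans (cong (f zero +_) (∑-+-split a b (f ∘ suc))) (sym (+-assoc (f zero) _ _))

∑-remQuot : ∀ a b (f : Fin a × Fin b → ℕ) →
  ∑[ i < a * b ] f (remQuot {a} b i) ≡ ∑[ x < a ] ∑[ y < b ] f (x , y)
∑-remQuot zero    b f = refl
∑-remQuot (suc a) b f = begin
  ∑[ i < b + a * b ] f (remQuot {suc a} b i)
    ≡⟨ ∑-+-split b (a * b) _ ⟩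
  ∑[ j < b ] f (remQuot {suc a} b (j ↑ˡ a * b)) + ∑[ i < a * b ] f (remQuot {suc a} b (b ↑ʳ i))
    ≡⟨ cong₂ _+_ (sum-cong-≗ first-block) (sum-cong-≗ later-blocks) ⟩
  ∑[ y < b ] f (zero , y) + ∑[ i < a * b ] f (suc (proj₁ (remQuot {a} b i)) , proj₂ (remQuot {a} b i))
    ≡⟨ cong (∑[ y < b ] f (zero , y) +_) (∑-remQuot a b (λ (x , y) → f (suc x , y))) ⟩
  ∑[ y < b ] f (zero , y) + ∑[ x < a ] ∑[ y < b ] f (suc x , y) ∎
  where
  open ≡-Reasoning
  first-block : ∀ j → f (remQuot {suc a} b (j ↑ˡ a * b)) ≡ f (zero , j)
  first-block j rewrite splitAt-↑ˡ b j (a * b) = refl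
  later-blocks : ∀ i →
    f (remQuot {suc a} b (b ↑ʳ i)) ≡ f (suc (proj₁ (remQuot {a} b i)) , proj₂ (remQuot {a} b i))
  later-blocks i rewrite splitAt-↑ʳ b (a * b) i = refl

𝟙 : ∀ {ℓ} {P : Set ℓ} → Dec P → ℕ
𝟙 (yes _) = 1
𝟙 (no _)  = 0

𝟙-mono : ∀ {ℓ ℓ′} {P : Set ℓ} {Q : Set ℓ′} (d : Dec P) (e : Dec Q) → (P → Q) → 𝟙 d ≤ 𝟙 e
𝟙-mono (yes _) (yes _) _   = ≤-refl
𝟙-mono (yes p) (no ¬q) P⇒Q = ⊥-elim (¬q (P⇒Q p))
𝟙-mono (no _)  _       _   = z≤n

module _ {ℓ ℓ′} {P : Set ℓ} {Q : Set ℓ′} where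

  𝟙-cong : (d : Dec P) (e : Dec Q) → (P → Q) → (Q → P) → 𝟙 d ≡ 𝟙 e
  𝟙-cong d e P⇒Q Q⇒P = ≤-antisym (𝟙-mono d e P⇒Q) (𝟙-mono e d Q⇒P)

  𝟙-× : (d : Dec P) (e : Dec Q) → 𝟙 (d ×-dec e) ≡ 𝟙 d * 𝟙 e
  𝟙-× (yes _) (yes _) = refl
  𝟙-× (yes _) (no _)  = refl
  𝟙-× (no _)  _       = refl

  𝟙-⊎ : (d : Dec P) (e : Dec Q) → 𝟙 (d ⊎-dec e) ≤ 𝟙 d + 𝟙 e
  𝟙-⊎ (yes _) _       = s≤s z≤n
  𝟙-⊎ (no _)  (yes _) = ≤-refl
  𝟙-⊎ (no _)  (no _)  = z≤n

module _ {ℓ} {P : Set ℓ} where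

  𝟙-yes : (d : Dec P) → P → 𝟙 d ≡ 1
  𝟙-yes (yes _) _ = refl
  𝟙-yes (no ¬p) p = ⊥-elim (¬p p)

  𝟙-no : (d : Dec P) → ¬ P → 𝟙 d ≡ 0
  𝟙-no (yes p) ¬p = ⊥-elim (¬p p)
  𝟙-no (no _)  _  = refl

  𝟙-≤-intro : ∀ {k} (d : Dec P) → (P → 1 ≤ k) → 𝟙 d ≤ k
  𝟙-≤-intro (yes p) P⇒1≤k = P⇒1≤k p
  𝟙-≤-intro (no _)  _     = z≤n

sum-𝟙-≟ : ∀ {k} (j : Fin k) (g : Fin k → ℕ) → ∑[ i < k ] (𝟙 (i ≟ᶠ j) * g i) ≡ g j
sum-𝟙-≟ {suc k} zero g = begin
  1 * g zero + ∑[ i < k ] (𝟙 (suc i ≟ᶠ zero) * g (suc i))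
    ≡⟨ cong₂ _+_ (*-identityˡ (g zero))
                 (sum-cong-≗ λ i → cong (_* g (suc i)) (𝟙-no (suc i ≟ᶠ zero) λ ())) ⟩
  g zero + ∑[ i < k ] 0
    ≡⟨ trans (cong (g zero +_) (sum-replicate-zero k)) (+-identityʳ _) ⟩
  g zero ∎
  where open ≡-Reasoning
sum-𝟙-≟ {suc k} (suc j) g = begin
  𝟙 (zero ≟ᶠ suc j) * g zero + ∑[ i < k ] (𝟙 (suc i ≟ᶠ suc j) * g (suc i))
    ≡⟨ cong₂ _+_ (cong (_* g zero) (𝟙-no (zero ≟ᶠ suc j) λ ()))
                 (sum-cong-≗ λ i → cong (_* g (suc i))
                   (𝟙-cong (suc i ≟ᶠ suc j) (i ≟ᶠ j) Fin-suc-injective (cong suc))) ⟩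
  0 + ∑[ i < k ] (𝟙 (i ≟ᶠ j) * g (suc i))
    ≡⟨ sum-𝟙-≟ j (g ∘ suc) ⟩
  g (suc j) ∎
  where open ≡-Reasoning

∑-pick+∑ : ∀ {k l} (x : Fin k) (a : Fin l → Fin k → ℕ) (w : Fin k → ℕ) →
  ∑[ y < k ] ((𝟙 (y ≟ᶠ x) + ∑[ c < l ] a c y) * w y) ≡ w x + ∑[ c < l ] ∑[ y < k ] (a c y * w y)
∑-pick+∑ {k} {l} x a w = begin
  ∑[ y < k ] ((𝟙 (y ≟ᶠ x) + ∑[ c < l ] a c y) * w y)
    ≡⟨ sum-cong-≗ (λ y → *-distribʳ-+ (w y) (𝟙 (y ≟ᶠ x)) _) ⟩
  ∑[ y < k ] (𝟙 (y ≟ᶠ x) * w y + (∑[ c < l ] a c y) * w y)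
    ≡⟨ ∑-distrib-+ (λ y → 𝟙 (y ≟ᶠ x) * w y) (λ y → (∑[ c < l ] a c y) * w y) ⟩
  ∑[ y < k ] (𝟙 (y ≟ᶠ x) * w y) + ∑[ y < k ] ((∑[ c < l ] a c y) * w y)
    ≡⟨ cong₂ _+_ (sum-𝟙-≟ x w) (sum-cong-≗ λ y → *-distribʳ-sum (w y) (λ c → a c y)) ⟩
  w x + ∑[ y < k ] ∑[ c < l ] (a c y * w y)
    ≡⟨ cong (w x +_) (∑-comm (λ y c → a c y * w y)) ⟩
  w x + ∑[ c < l ] ∑[ y < k ] (a c y * w y) ∎
  where open ≡-Reasoning

count : ∀ {k} {P : Fin k → Set} → Decidable P → ℕ
count {k} P? = ∑[ i < k ] 𝟙 (P? i)

count-mono : ∀ {k} {P Q : Fin k → Set} (P? : Decidable P) (Q? : Decidable Q) →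
  (∀ i → P i → Q i) → count P? ≤ count Q?
count-mono P? Q? P⇒Q = sum-mono-≤ λ i → 𝟙-mono (P? i) (Q? i) (P⇒Q i)

𝟙-any≤sum : ∀ {k} {P : Fin k → Set} (P? : Decidable P) → 𝟙 (any? P?) ≤ ∑[ i < k ] 𝟙 (P? i)
𝟙-any≤sum P? = 𝟙-≤-intro (any? P?) λ (i , pi) →
  subst (_≤ _) (𝟙-yes (P? i) pi) (term≤sum (λ i → 𝟙 (P? i)) i)

𝟙-∈-∷ : ∀ {k} x (p : Subset k) i → 𝟙 (i ∈? p) ≡ 𝟙 (suc i ∈? (x ∷ p))
𝟙-∈-∷ x p i = 𝟙-cong (i ∈? p) (suc i ∈? (x ∷ p)) there λ { (there i∈p) → i∈p }

∣p∣≡count : ∀ {k} (p : Subset k) → ∣ p ∣ ≡ count (_∈? p)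
∣p∣≡count []            = refl
∣p∣≡count (inside ∷ p)  = cong suc (trans (∣p∣≡count p) (sum-cong-≗ (𝟙-∈-∷ inside p)))
∣p∣≡count (outside ∷ p) = trans (∣p∣≡count p) (sum-cong-≗ (𝟙-∈-∷ outside p))

-- Walks and paths

module _ {G : Graph} where

  startsIn : ∀ {P u v} → Walk G P u v → P u
  startsIn [ pu ]         = pu
  startsIn (pu ∷⟨ _ ⟩ _) = pu

  endsIn : ∀ {P u v} → Walk G P u v → P v
  endsIn [ pv ]         = pv
  endsIn (_ ∷⟨ _ ⟩ w) = endsIn w

  _++ʷ_ : ∀ {P u v w} → Walk G P u v → Walk G P v w → Walk G P u w
  [ _ ]           ++ʷ w′ = w′
  (pu ∷⟨ e ⟩ w) ++ʷ w′ = pu ∷⟨ e ⟩ (w ++ʷ w′)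

  reverseʷ : ∀ {P u v} → Walk G P u v → Walk G P v u
  reverseʷ [ pu ]         = [ pu ]
  reverseʷ (pu ∷⟨ e ⟩ w) = reverseʷ w ++ʷ (startsIn w ∷⟨ adj-sym G e ⟩ [ pu ])

  weakenʷ : ∀ {P Q : Fin (n G) → Set} {u v} → (∀ {x} → P x → Q x) → Walk G P u v → Walk G Q u v
  weakenʷ P⇒Q [ pu ]         = [ P⇒Q pu ]
  weakenʷ P⇒Q (pu ∷⟨ e ⟩ w) = P⇒Q pu ∷⟨ e ⟩ weakenʷ P⇒Q w

  _∈ʷ_ : ∀ {P u v} → Fin (n G) → Walk G P u v → Set
  _∈ʷ_ {u = u} x [ _ ]         = x ≡ u
  _∈ʷ_ {u = u} x (_ ∷⟨ _ ⟩ w) = x ≡ u ⊎ x ∈ʷ w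

  _∈ʷ?_ : ∀ {P u v} (x : Fin (n G)) (w : Walk G P u v) → Dec (x ∈ʷ w)
  _∈ʷ?_ {u = u} x [ _ ]         = x ≟ᶠ u
  _∈ʷ?_ {u = u} x (_ ∷⟨ _ ⟩ w) = (x ≟ᶠ u) ⊎-dec (x ∈ʷ? w)

  ∈ʷ⇒P : ∀ {P u v x} (w : Walk G P u v) → x ∈ʷ w → P x
  ∈ʷ⇒P [ pu ]         refl        = pu
  ∈ʷ⇒P (pu ∷⟨ _ ⟩ w) (inj₁ refl) = pu
  ∈ʷ⇒P (_ ∷⟨ _ ⟩ w)  (inj₂ x∈w)  = ∈ʷ⇒P w x∈w

  IsPath : ∀ {P u v} → Walk G P u v → Set
  IsPath [ _ ]                   = ⊤
  IsPath {u = u} (_ ∷⟨ _ ⟩ w) = ¬ (u ∈ʷ w) × IsPath w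

  suffixFrom : ∀ {P u v x} (w : Walk G P u v) → IsPath w → x ∈ʷ w → Σ[ w′ ∈ Walk G P x v ] IsPath w′
  suffixFrom [ pu ]           path       refl        = [ pu ] , path
  suffixFrom w@(_ ∷⟨ _ ⟩ _) path       (inj₁ refl) = w , path
  suffixFrom (_ ∷⟨ _ ⟩ w)    (_ , path) (inj₂ x∈w)  = suffixFrom w path x∈w

  toPath : ∀ {P u v} → Walk G P u v → Σ[ w′ ∈ Walk G P u v ] IsPath w′
  toPath [ pu ] = [ pu ] , tt
  toPath {u = u} (pu ∷⟨ e ⟩ w) with toPath w
  ... | w′ , path with u ∈ʷ? w′
  ...   | yes u∈w′ = suffixFrom w′ path u∈w′
  ...   | no u∉w′  = (pu ∷⟨ e ⟩ w′) , u∉w′ , path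

  length : ∀ {P u v} → Walk G P u v → ℕ
  length [ _ ]         = 0
  length (_ ∷⟨ _ ⟩ w) = suc (length w)

  vertexAt : ∀ {P u v} (w : Walk G P u v) → Fin (suc (length w)) → Fin (n G)
  vertexAt {u = u} [ _ ]         zero    = u
  vertexAt {u = u} (_ ∷⟨ _ ⟩ w) zero    = u
  vertexAt         (_ ∷⟨ _ ⟩ w) (suc i) = vertexAt w i

  vertexAt-∈ʷ : ∀ {P u v} (w : Walk G P u v) i → vertexAt w i ∈ʷ w
  vertexAt-∈ʷ [ _ ]         zero    = refl
  vertexAt-∈ʷ (_ ∷⟨ _ ⟩ w) zero    = inj₁ refl
  vertexAt-∈ʷ (_ ∷⟨ _ ⟩ w) (suc i) = inj₂ (vertexAt-∈ʷ w i)

  vertexAt-injective : ∀ {P u v} (w : Walk G P u v) → IsPath w →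
    ∀ {i j} → vertexAt w i ≡ vertexAt w j → i ≡ j
  vertexAt-injective [ _ ]         _            {zero}  {zero}  _  = refl
  vertexAt-injective (_ ∷⟨ _ ⟩ w) _            {zero}  {zero}  _  = refl
  vertexAt-injective (_ ∷⟨ _ ⟩ w) (u∉w , _)   {zero}  {suc j} eq = ⊥-elim (u∉w (subst (_∈ʷ w) (sym eq) (vertexAt-∈ʷ w j)))
  vertexAt-injective (_ ∷⟨ _ ⟩ w) (u∉w , _)   {suc i} {zero}  eq = ⊥-elim (u∉w (subst (_∈ʷ w) eq (vertexAt-∈ʷ w i)))
  vertexAt-injective (_ ∷⟨ _ ⟩ w) (_ , path)  {suc i} {suc j} eq = cong suc (vertexAt-injective w path eq)

  vertexAt-adj : ∀ {P u v} (w : Walk G P u v) (i : Fin (length w)) →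
    Adj G (vertexAt w (inject₁ i)) (vertexAt w (suc i))
  vertexAt-adj (_ ∷⟨ e ⟩ [ _ ])         zero    = e
  vertexAt-adj (_ ∷⟨ e ⟩ (_ ∷⟨ _ ⟩ _)) zero    = e
  vertexAt-adj (_ ∷⟨ _ ⟩ w)             (suc i) = vertexAt-adj w i

  vertexAt-last : ∀ {P u v} (w : Walk G P u v) → vertexAt w (fromℕ (length w)) ≡ v
  vertexAt-last [ _ ]         = refl
  vertexAt-last (_ ∷⟨ _ ⟩ w) = vertexAt-last w

next-inject₁ : ∀ {k} (j : Fin k) → next (inject₁ j) ≡ suc j
next-inject₁ {k} j = toℕ-injective (begin
  toℕ (next (inject₁ j))           ≡⟨ toℕ-fromℕ< _ ⟩
  suc (toℕ (inject₁ j)) % suc k    ≡⟨ cong (λ i → suc i % suc k) (toℕ-inject₁ j) ⟩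
  suc (toℕ j) % suc k              ≡⟨ m<n⇒m%n≡m (s≤s (toℕ<n j)) ⟩
  suc (toℕ j)                      ∎)
  where open ≡-Reasoning

next-fromℕ : ∀ k → next (fromℕ k) ≡ zero
next-fromℕ k = toℕ-injective (begin
  toℕ (next (fromℕ k))         ≡⟨ toℕ-fromℕ< _ ⟩
  suc (toℕ (fromℕ k)) % suc k  ≡⟨ cong (λ i → suc i % suc k) (toℕ-fromℕ k) ⟩
  suc k % suc k                ≡⟨ n%n≡0 (suc k) ⟩
  0                            ∎)
  where open ≡-Reasoning

inject₁-or-fromℕ : ∀ {k} (i : Fin (suc k)) → (∃[ j ] i ≡ inject₁ j) ⊎ i ≡ fromℕ k
inject₁-or-fromℕ {zero}  zero    = inj₂ refl
inject₁-or-fromℕ {suc k} zero    = inj₁ (zero , refl)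
inject₁-or-fromℕ {suc k} (suc i) with inject₁-or-fromℕ i
... | inj₁ (j , refl) = inj₁ (suc j , refl)
... | inj₂ refl       = inj₂ refl

-- Such a walk, shortened to a path and closed up through x, would be a cycle.
acyclic⇒no-detour : ∀ (T : Graph) → ¬ HasCycle T → ∀ {x y z} → Adj T x y → Adj T x z → y ≢ z →
  ¬ Walk T (_≢ x) y z
acyclic⇒no-detour T acyclic {x} {y} {z} xy xz y≢z detour with toPath detour
... | [ _ ] , _ = y≢z refl
... | w@(_ ∷⟨ _ ⟩ w′) , path = acyclic (length w′ , cycle , cycle-injective , cycle-adj)
  where
  cycle : Fin (3 + length w′) → Fin (n T)
  cycle zero    = x
  cycle (suc i) = vertexAt w i
  avoids-x : ∀ i → vertexAt w i ≢ x
  avoids-x i = ∈ʷ⇒P w (vertexAt-∈ʷ w i)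
  cycle-injective : ∀ {i j} → cycle i ≡ cycle j → i ≡ j
  cycle-injective {zero}  {zero}  _  = refl
  cycle-injective {zero}  {suc j} eq = ⊥-elim (avoids-x j (sym eq))
  cycle-injective {suc i} {zero}  eq = ⊥-elim (avoids-x i eq)
  cycle-injective {suc i} {suc j} eq = cong suc (vertexAt-injective w path eq)
  cycle-adj : ∀ i → Adj T (cycle i) (cycle (next i))
  cycle-adj i with inject₁-or-fromℕ i
  ... | inj₂ refl rewrite next-fromℕ (2 + length w′) =
    subst (λ v → Adj T v x) (sym (vertexAt-last w)) (adj-sym T xz)
  ... | inj₁ (zero  , refl) rewrite next-inject₁ {2 + length w′} zero    = xy
  ... | inj₁ (suc j , refl) rewrite next-inject₁ {2 + length w′} (suc j) = vertexAt-adj w j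

-- Rooting a tree

Minimal : ∀ {p} → (ℕ → Set p) → ℕ → Set p
Minimal P k = P k × (∀ {i} → i < k → ¬ P i)

module _ {p} {P : ℕ → Set p} (P? : Decidable P) where

  minimal-or-none : ∀ ℓ → ∃ (Minimal P) ⊎ (∀ {i} → i ≤ ℓ → ¬ P i)
  minimal-or-none zero with P? 0
  ... | yes p0 = inj₁ (0 , p0 , λ ())
  ... | no ¬p0 = inj₂ λ { z≤n → ¬p0 }
  minimal-or-none (suc ℓ) with minimal-or-none ℓ | P? (suc ℓ)
  ... | inj₁ found | _     = inj₁ found
  ... | inj₂ none  | yes p = inj₁ (suc ℓ , p , none ∘ ≤-pred)
  ... | inj₂ none  | no ¬p =
    inj₂ λ i≤1+ℓ → [ none ∘ ≤-pred , (λ { refl → ¬p }) ]′ (m≤n⇒m<n∨m≡n i≤1+ℓ)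

  least : ∀ {ℓ} → P ℓ → ∃ (Minimal P)
  least {ℓ} pℓ = [ (λ found → found) , (λ none → ⊥-elim (none ≤-refl pℓ)) ]′ (minimal-or-none ℓ)

record Rooting (T : Graph) : Set where
  field
    depth  : Fin (n T) → ℕ
    parent : Fin (n T) → Fin (n T)
    parent-spec : ∀ x {d} → depth x ≡ suc d → Adj T (parent x) x × depth (parent x) ≡ d

  ChildOf : Fin (n T) → Fin (n T) → Set
  ChildOf c x = depth c ≡ suc (depth x) × parent c ≡ x

  field
    edge-child : ∀ {x y} → Adj T x y → ChildOf x y ⊎ ChildOf y x

module Rooted (T : Graph) (root : Fin (n T)) (connected : ∀ v → Walk T (λ _ → ⊤) root v)
              (acyclic : ¬ HasCycle T) where

  Reach : ℕ → Fin (n T) → Set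
  Reach zero    x = x ≡ root
  Reach (suc k) x = Reach k x ⊎ ∃[ y ] (Adj T y x × Reach k y)

  reach? : ∀ k → Decidable (Reach k)
  reach? zero    x = x ≟ᶠ root
  reach? (suc k) x = reach? k x ⊎-dec any? (λ y → adj? T y x ×-dec reach? k y)

  walk⇒reach : ∀ {P u v} (w : Walk T P u v) {k} → Reach k u → Reach (k + length w) v
  walk⇒reach {v = v} [ _ ]          {k} ru = subst (λ i → Reach i v) (sym (+-identityʳ k)) ru
  walk⇒reach {v = v} (_ ∷⟨ e ⟩ w) {k} ru =
    subst (λ i → Reach i v) (sym (+-suc k (length w))) (walk⇒reach w (inj₂ (_ , e , ru)))

  depth-minimal : ∀ x → ∃ (Minimal (λ k → Reach k x))
  depth-minimal x = least (λ k → reach? k x) (walk⇒reach (connected x) {0} refl)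

  depth : Fin (n T) → ℕ
  depth x = proj₁ (depth-minimal x)

  reach-depth : ∀ x → Reach (depth x) x
  reach-depth x = proj₁ (proj₂ (depth-minimal x))

  depth≤ : ∀ {k x} → Reach k x → depth x ≤ k
  depth≤ {k} {x} rx = ≮⇒≥ λ k<depth → proj₂ (proj₂ (depth-minimal x)) k<depth rx

  depth≡0⇒root : ∀ {x} → depth x ≡ 0 → x ≡ root
  depth≡0⇒root {x} d≡0 = subst (λ k → Reach k x) d≡0 (reach-depth x)

  predecessor : ∀ k x → Reach k x → Fin (n T)
  predecessor zero    x _                  = root
  predecessor (suc k) x (inj₁ rx)          = predecessor k x rx
  predecessor (suc k) x (inj₂ (y , _ , _)) = y

  parent : Fin (n T) → Fin (n T)
  parent x = predecessor (depth x) x (reach-depth x)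

  parent-spec : ∀ x {d} → depth x ≡ suc d → Adj T (parent x) x × depth (parent x) ≡ d
  parent-spec x {d} d≡1+d = spec (depth x) d≡1+d (reach-depth x) (proj₂ (proj₂ (depth-minimal x)))
    where
    spec : ∀ k → k ≡ suc d → (rx : Reach k x) → (∀ {i} → i < k → ¬ Reach i x) →
      Adj T (predecessor k x rx) x × depth (predecessor k x rx) ≡ d
    spec (suc k) refl (inj₁ rx) below = ⊥-elim (below ≤-refl rx)
    spec (suc k) refl (inj₂ (y , yx , ry)) below =
      yx , ≤-antisym (depth≤ ry) (≮⇒≥ λ depth<k → below (s≤s depth<k) (inj₂ (y , yx , reach-depth y)))

  Below : Fin (n T) → Fin (n T) → Set
  Below x q = q ≡ x ⊎ depth q < depth x

  pathToRoot : ∀ x → Walk T (Below x) x root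
  pathToRoot x = go (depth x) x refl
    where
    go : ∀ k x → depth x ≡ k → Walk T (Below x) x root
    go zero    x d≡0   = subst (Walk T (Below x) x) (depth≡0⇒root d≡0) [ inj₁ refl ]
    go (suc k) x d≡1+k with parent-spec x d≡1+k
    ... | px , dp≡k = inj₁ refl ∷⟨ adj-sym T px ⟩ weakenʷ lower (go k (parent x) dp≡k)
      where
      dp<dx : depth (parent x) < depth x
      dp<dx = subst₂ _<_ (sym dp≡k) (sym d≡1+k) ≤-refl
      lower : ∀ {q} → Below (parent x) q → Below x q
      lower (inj₁ refl) = inj₂ dp<dx
      lower (inj₂ dq<dp) = inj₂ (<-trans dq<dp dp<dx)

  pathToRoot-avoiding : ∀ {x z} → depth x ≤ depth z → x ≢ z → Walk T (_≢ z) x root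
  pathToRoot-avoiding {x} {z} dx≤dz x≢z = weakenʷ avoids (pathToRoot x)
    where
    avoids : ∀ {q} → Below x q → q ≢ z
    avoids (inj₁ refl)  = x≢z
    avoids (inj₂ dq<dx) refl = <-irrefl refl (<-≤-trans dq<dx dx≤dz)

  adj⇒≢ : ∀ {x y} → Adj T x y → x ≢ y
  adj⇒≢ xy refl = irrefl T xy

  -- Otherwise y and the parent of z would be joined through the root by a walk avoiding z.
  shallow-neighbour≡parent : ∀ {y z d} → Adj T y z → depth y ≤ depth z → depth z ≡ suc d → y ≡ parent z
  shallow-neighbour≡parent {y} {z} {d} yz dy≤dz dz≡1+d with y ≟ᶠ parent z | parent-spec z dz≡1+d
  ... | yes y≡p | _         = y≡p
  ... | no y≢p  | pz , dp≡d = ⊥-elim (acyclic⇒no-detour T acyclic (adj-sym T yz) (adj-sym T pz) y≢p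
      (pathToRoot-avoiding dy≤dz (adj⇒≢ yz) ++ʷ reverseʷ (pathToRoot-avoiding dp≤dz (adj⇒≢ pz))))
    where
    dp≤dz : depth (parent z) ≤ depth z
    dp≤dz = subst₂ _≤_ (sym dp≡d) (sym dz≡1+d) (n≤1+n d)

  deeper-end-is-child : ∀ {x y} → Adj T x y → depth x ≤ depth y → depth y ≡ suc (depth x) × parent y ≡ x
  deeper-end-is-child {x} {y} xy dx≤dy = by-depth (depth y) refl
    where
    by-depth : ∀ k → depth y ≡ k → depth y ≡ suc (depth x) × parent y ≡ x
    by-depth zero dy≡0 =
      ⊥-elim (adj⇒≢ xy (trans (depth≡0⇒root (n≤0⇒n≡0 (subst (depth x ≤_) dy≡0 dx≤dy)))
                              (sym (depth≡0⇒root dy≡0))))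
    by-depth (suc d) dy≡1+d = trans dy≡1+d (cong suc (sym (trans (cong depth x≡p) dp≡d))) , sym x≡p
      where
      x≡p : x ≡ parent y
      x≡p = shallow-neighbour≡parent xy dx≤dy dy≡1+d
      dp≡d : depth (parent y) ≡ d
      dp≡d = proj₂ (parent-spec y dy≡1+d)

  edge-child : ∀ {x y} → Adj T x y →
    (depth x ≡ suc (depth y) × parent x ≡ y) ⊎ (depth y ≡ suc (depth x) × parent y ≡ x)
  edge-child xy with ≤-total (depth _) (depth _)
  ... | inj₁ dx≤dy = inj₂ (deeper-end-is-child xy dx≤dy)
  ... | inj₂ dy≤dx = inj₁ (deeper-end-is-child (adj-sym T xy) dy≤dx)

rooting : ∀ T → IsTree T → Rooting T
rooting T (1≤n , connected , acyclic) = record { Rooted T (fromℕ< 1≤n) (connected (fromℕ< 1≤n)) acyclic }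

-- Greedy cutting of a weighted rooted tree

∸≡suc∸suc : ∀ {m n} → n < m → m ∸ n ≡ suc (m ∸ suc n)
∸≡suc∸suc {suc m} {zero}  _         = refl
∸≡suc∸suc {suc m} {suc n} (s≤s n<m) = ∸≡suc∸suc n<m

module GreedyCut {T : Graph} (R : Rooting T) (weight : Fin (n T) → ℕ) (m : ℕ) where

  open Rooting R

  N : ℕ
  N = n T

  child? : ∀ c x → Dec (ChildOf c x)
  child? c x = (depth c ≟ suc (depth x)) ×-dec (parent c ≟ᶠ x)

  -- What a child passes on to its parent: its residual weight, or nothing once it is cut.
  clip : ℕ → ℕ
  clip r = 𝟙 (r ≤? m) * r

  residual′ : ℕ → Fin N → ℕ
  residual′ zero    x = weight x
  residual′ (suc k) x = weight x + ∑[ c < N ] (𝟙 (child? c x) * clip (residual′ k c))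

  -- Any bound on the depths serves as fuel for the recursion defining the residual weights.
  height : ℕ
  height = ∑[ x < N ] suc (depth x)

  depth<height : ∀ x → depth x < height
  depth<height = term≤sum (suc ∘ depth)

  residual : Fin N → ℕ
  residual x = residual′ (height ∸ depth x) x

  residual-rec : ∀ x → residual x ≡ weight x + ∑[ c < N ] (𝟙 (child? c x) * clip (residual c))
  residual-rec x rewrite ∸≡suc∸suc (depth<height x) = cong (weight x +_) (sum-cong-≗ same-fuel)
    where
    same-fuel : ∀ c →
      𝟙 (child? c x) * clip (residual′ (height ∸ suc (depth x)) c) ≡ 𝟙 (child? c x) * clip (residual c)
    same-fuel c with child? c x
    ... | yes (dc≡ , _) = cong (λ d → 1 * clip (residual′ (height ∸ d) c)) (sym dc≡)
    ... | no _          = refl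

  Cut : Fin N → Set
  Cut x = m < residual x

  cut? : Decidable Cut
  cut? x = m <? residual x

  at-most-one-parent : ∀ c → ∑[ x < N ] 𝟙 (child? c x) ≤ 1
  at-most-one-parent c = begin
    ∑[ x < N ] 𝟙 (child? c x)             ≤⟨ sum-mono-≤ (λ x → 𝟙≤𝟙*1 x) ⟩
    ∑[ x < N ] (𝟙 (x ≟ᶠ parent c) * 1)   ≡⟨ sum-𝟙-≟ (parent c) (λ _ → 1) ⟩
    1                                      ∎
    where
    open ≤-Reasoning
    𝟙≤𝟙*1 : ∀ x → 𝟙 (child? c x) ≤ 𝟙 (x ≟ᶠ parent c) * 1
    𝟙≤𝟙*1 x = subst (𝟙 (child? c x) ≤_) (sym (*-identityʳ _))
                    (𝟙-mono (child? c x) (x ≟ᶠ parent c) (sym ∘ proj₂))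

  sum-residual≤ : sum residual ≤ sum weight + ∑[ c < N ] clip (residual c)
  sum-residual≤ = begin
    sum residual
      ≡⟨ sum-cong-≗ residual-rec ⟩
    ∑[ x < N ] (weight x + ∑[ c < N ] (𝟙 (child? c x) * clip (residual c)))
      ≡⟨ ∑-distrib-+ weight (λ x → ∑[ c < N ] (𝟙 (child? c x) * clip (residual c))) ⟩
    sum weight + ∑[ x < N ] ∑[ c < N ] (𝟙 (child? c x) * clip (residual c))
      ≡⟨ cong (sum weight +_) (∑-comm (λ x c → 𝟙 (child? c x) * clip (residual c))) ⟩
    sum weight + ∑[ c < N ] ∑[ x < N ] (𝟙 (child? c x) * clip (residual c))
      ≡⟨ cong (sum weight +_) (sum-cong-≗ λ c →
           trans (sum-cong-≗ λ x → *-comm (𝟙 (child? c x)) _)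
                 (sym (*-distribˡ-sum (clip (residual c)) (λ x → 𝟙 (child? c x))))) ⟩
    sum weight + ∑[ c < N ] (clip (residual c) * ∑[ x < N ] 𝟙 (child? c x))
      ≤⟨ +-monoʳ-≤ (sum weight) (sum-mono-≤ λ c → *-monoʳ-≤ (clip (residual c)) (at-most-one-parent c)) ⟩
    sum weight + ∑[ c < N ] (clip (residual c) * 1)
      ≡⟨ cong (sum weight +_) (sum-cong-≗ {N} λ c → *-identityʳ (clip (residual c))) ⟩
    sum weight + ∑[ c < N ] clip (residual c) ∎
    where open ≤-Reasoning

  clip-small : ∀ {r} → r ≤ m → clip r ≡ r
  clip-small {r} r≤m rewrite 𝟙-yes (r ≤? m) r≤m = *-identityˡ r

  clip+cut : ∀ r → clip r + 𝟙 (m <? r) * r ≡ r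
  clip+cut r with r ≤? m | m <? r
  ... | yes r≤m | yes m<r = ⊥-elim (<⇒≱ m<r r≤m)
  ... | yes _   | no _    = trans (+-identityʳ _) (*-identityˡ r)
  ... | no _    | yes _   = *-identityˡ r
  ... | no r≰m  | no m≮r  = ⊥-elim (r≰m (≮⇒≥ m≮r))

  cut-count : suc m * count cut? ≤ sum weight
  cut-count = +-cancelʳ-≤ (∑[ c < N ] clip (residual c)) _ _ (begin
    suc m * count cut? + ∑[ c < N ] clip (residual c)
      ≡⟨ cong (_+ ∑[ c < N ] clip (residual c)) (*-distribˡ-sum (suc m) (λ c → 𝟙 (cut? c))) ⟩
    ∑[ c < N ] (suc m * 𝟙 (cut? c)) + ∑[ c < N ] clip (residual c)
      ≤⟨ +-monoˡ-≤ _ (sum-mono-≤ cut⇒heavy) ⟩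
    ∑[ c < N ] (𝟙 (cut? c) * residual c) + ∑[ c < N ] clip (residual c)
      ≡⟨ +-comm _ (∑[ c < N ] clip (residual c)) ⟩
    ∑[ c < N ] clip (residual c) + ∑[ c < N ] (𝟙 (cut? c) * residual c)
      ≡⟨ sym (∑-distrib-+ (clip ∘ residual) (λ c → 𝟙 (cut? c) * residual c)) ⟩
    ∑[ c < N ] (clip (residual c) + 𝟙 (cut? c) * residual c)
      ≡⟨ sum-cong-≗ (clip+cut ∘ residual) ⟩
    sum residual
      ≤⟨ sum-residual≤ ⟩
    sum weight + ∑[ c < N ] clip (residual c) ∎)
    where
    open ≤-Reasoning
    cut⇒heavy : ∀ c → suc m * 𝟙 (cut? c) ≤ 𝟙 (cut? c) * residual c
    cut⇒heavy c with cut? c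
    ... | yes m<r = subst₂ _≤_ (sym (*-identityʳ (suc m))) (sym (*-identityˡ _)) m<r
    ... | no _    = subst (_≤ 0) (sym (*-zeroʳ (suc m))) z≤n

  -- y reaches its ancestor x climbing through uncut nodes only (x itself may be cut).
  ClimbsWithin : ℕ → Fin N → Fin N → Set
  ClimbsWithin zero    y x = y ≡ x
  ClimbsWithin (suc k) y x = y ≡ x ⊎ (¬ Cut y × ClimbsWithin k (parent y) x)

  climbsWithin? : ∀ k y x → Dec (ClimbsWithin k y x)
  climbsWithin? zero    y x = y ≟ᶠ x
  climbsWithin? (suc k) y x = (y ≟ᶠ x) ⊎-dec (¬? (cut? y) ×-dec climbsWithin? k (parent y) x)

  ClimbsTo : Fin N → Fin N → Set
  ClimbsTo y x = ClimbsWithin (depth y) y x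

  climbsTo? : ∀ y x → Dec (ClimbsTo y x)
  climbsTo? y = climbsWithin? (depth y) y

  climbs-refl : ∀ k x → ClimbsWithin k x x
  climbs-refl zero    x = refl
  climbs-refl (suc k) x = inj₁ refl

  climbs-step : ∀ {y x k} → depth y ≡ suc k → ¬ Cut y → ClimbsTo (parent y) x → ClimbsTo y x
  climbs-step {y} {x} dy≡1+k ¬cut up = subst (λ d → ClimbsWithin d y x) (sym dy≡1+k)
    (inj₂ (¬cut , subst (λ d → ClimbsWithin d (parent y) x) (proj₂ (parent-spec y dy≡1+k)) up))

  climbs-through-child : ∀ {y x} → ClimbsTo y x → y ≢ x → ∃[ c ] (ChildOf c x × ¬ Cut c × ClimbsTo y c)
  climbs-through-child {y} {x} = go (depth y) y refl
    where
    go : ∀ k y → depth y ≡ k → ClimbsTo y x → y ≢ x → ∃[ c ] (ChildOf c x × ¬ Cut c × ClimbsTo y c)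
    go zero y dy≡0 up y≢x = ⊥-elim (y≢x (subst (λ d → ClimbsWithin d y x) dy≡0 up))
    go (suc k) y dy≡1+k up y≢x with subst (λ d → ClimbsWithin d y x) dy≡1+k up | parent-spec y dy≡1+k
    ... | inj₁ y≡x             | _ = ⊥-elim (y≢x y≡x)
    ... | inj₂ (¬cut , up′) | _ , dp≡k with parent y ≟ᶠ x
    ...   | yes p≡x =
      y , (trans dy≡1+k (cong suc (trans (sym dp≡k) (cong depth p≡x))) , p≡x) , ¬cut , climbs-refl (depth y) y
    ...   | no p≢x with go k (parent y) dp≡k (subst (λ d → ClimbsWithin d (parent y) x) (sym dp≡k) up′) p≢x
    ...     | c , c-child , ¬cut-c , p-up = c , c-child , ¬cut-c , climbs-step dy≡1+k ¬cut p-up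

  top′ : ℕ → Fin N → Fin N
  top′ zero    a = a
  top′ (suc k) a with cut? (parent a)
  ... | yes _ = a
  ... | no _  = top′ k (parent a)

  top : Fin N → Fin N
  top a = top′ (depth a) a

  climbs-to-top : ∀ {a} → ¬ Cut a → ClimbsTo a (top a) × ¬ Cut (top a)
  climbs-to-top {a} = go (depth a) a refl
    where
    go : ∀ k a → depth a ≡ k → ¬ Cut a → ClimbsWithin k a (top′ k a) × ¬ Cut (top′ k a)
    go zero    a _       ¬cut = refl , ¬cut
    go (suc k) a da≡1+k ¬cut with cut? (parent a)
    ... | yes _     = inj₁ refl , ¬cut
    ... | no ¬cut-p = let up , ¬cut-top = go k (parent a) (proj₂ (parent-spec a da≡1+k)) ¬cut-p in
                      inj₂ (¬cut , up) , ¬cut-top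

  top-child : ∀ {c x} → ChildOf c x → ¬ Cut x → top c ≡ top x
  top-child {c} (dc≡ , refl) ¬cut-p rewrite dc≡ with cut? (parent c)
  ... | yes cut-p = ⊥-elim (¬cut-p cut-p)
  ... | no _      = refl

  top-edge : ∀ {a b} → Adj T a b → ¬ Cut a → ¬ Cut b → top a ≡ top b
  top-edge ab ¬cut-a ¬cut-b with edge-child ab
  ... | inj₁ a-child = top-child a-child ¬cut-b
  ... | inj₂ b-child = sym (top-child b-child ¬cut-a)

  top-walk : ∀ {a b} → Walk T (¬_ ∘ Cut) a b → top a ≡ top b
  top-walk [ _ ]           = refl
  top-walk (¬cut ∷⟨ e ⟩ w) = trans (top-edge e ¬cut (startsIn w)) (top-walk w)

  ViaChild : Fin N → (Fin N → Set) → Fin N → Fin N → Set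
  ViaChild x Q c y = (ChildOf c x × ¬ Cut c) × (Q y × ClimbsTo y c)

  viaChild? : ∀ x {Q} → Decidable Q → ∀ c y → Dec (ViaChild x Q c y)
  viaChild? x Q? c y = (child? c x ×-dec ¬? (cut? c)) ×-dec (Q? y ×-dec climbsTo? y c)

  at-top-or-via-child : ∀ x {Q} (Q? : Decidable Q) → (∀ y → Q y → ClimbsTo y x) →
    ∀ y → 𝟙 (Q? y) ≤ 𝟙 (y ≟ᶠ x) + ∑[ c < N ] 𝟙 (viaChild? x Q? c y)
  at-top-or-via-child x {Q} Q? Q⇒climbs y = 𝟙-≤-intro (Q? y) top-or-via
    where
    top-or-via : Q y → 1 ≤ 𝟙 (y ≟ᶠ x) + ∑[ c < N ] 𝟙 (viaChild? x Q? c y)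
    top-or-via q with y ≟ᶠ x
    ... | yes _  = s≤s z≤n
    ... | no y≢x with climbs-through-child (Q⇒climbs y q) y≢x
    ...   | c , c-child , ¬cut-c , up =
      subst (_≤ _) (𝟙-yes (viaChild? x Q? c y) ((c-child , ¬cut-c) , q , up))
                   (term≤sum (λ c → 𝟙 (viaChild? x Q? c y)) c)

  region-weight≤residual : ∀ x {Q : Fin N → Set} (Q? : Decidable Q) → (∀ y → Q y → ClimbsTo y x) →
    ∑[ y < N ] (𝟙 (Q? y) * weight y) ≤ residual x
  region-weight≤residual x = go (height ∸ depth x) x refl
    where
    go : ∀ k x → height ∸ depth x ≡ k →
      ∀ {Q : Fin N → Set} (Q? : Decidable Q) → (∀ y → Q y → ClimbsTo y x) →
      ∑[ y < N ] (𝟙 (Q? y) * weight y) ≤ residual x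
    go zero    x fuel≡0 _ _ = ⊥-elim (0≢1+n (trans (sym fuel≡0) (∸≡suc∸suc (depth<height x))))
    go (suc k) x fuel≡1+k {Q} Q? Q⇒climbs = begin
      ∑[ y < N ] (𝟙 (Q? y) * weight y)
        ≤⟨ sum-mono-≤ (λ y → *-monoˡ-≤ (weight y) (at-top-or-via-child x Q? Q⇒climbs y)) ⟩
      ∑[ y < N ] ((𝟙 (y ≟ᶠ x) + ∑[ c < N ] 𝟙 (viaChild? x Q? c y)) * weight y)
        ≡⟨ ∑-pick+∑ x (λ c y → 𝟙 (viaChild? x Q? c y)) weight ⟩
      weight x + ∑[ c < N ] ∑[ y < N ] (𝟙 (viaChild? x Q? c y) * weight y)
        ≤⟨ +-monoʳ-≤ (weight x) (sum-mono-≤ λ c → via-child c (child? c x ×-dec ¬? (cut? c))) ⟩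
      weight x + ∑[ c < N ] (𝟙 (child? c x) * clip (residual c))
        ≡⟨ residual-rec x ⟨
      residual x ∎
      where
      open ≤-Reasoning
      via-child : ∀ c → Dec (ChildOf c x × ¬ Cut c) →
        ∑[ y < N ] (𝟙 (viaChild? x Q? c y) * weight y) ≤ 𝟙 (child? c x) * clip (residual c)
      via-child c (no ¬uncut-child) = ≤-trans (≤-reflexive (trans
        (sum-cong-≗ λ y → cong (_* weight y) (𝟙-no (viaChild? x Q? c y) (¬uncut-child ∘ proj₁)))
        (sum-replicate-zero N))) z≤n
      via-child c (yes (c-child , ¬cut-c)) = begin
        ∑[ y < N ] (𝟙 (viaChild? x Q? c y) * weight y)
          ≡⟨ sum-cong-≗ (λ y → cong (_* weight y)
               (𝟙-cong (viaChild? x Q? c y) (Q? y ×-dec climbsTo? y c) proj₂ ((c-child , ¬cut-c) ,_))) ⟩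
        ∑[ y < N ] (𝟙 (Q? y ×-dec climbsTo? y c) * weight y)
          ≤⟨ go k c fuel-c (λ y → Q? y ×-dec climbsTo? y c) (λ _ → proj₂) ⟩
        residual c
          ≡⟨ clip-small (≮⇒≥ ¬cut-c) ⟨
        clip (residual c)
          ≡⟨ trans (cong (_* clip (residual c)) (𝟙-yes (child? c x) c-child)) (*-identityˡ _) ⟨
        𝟙 (child? c x) * clip (residual c) ∎
        where
        fuel-c : height ∸ depth c ≡ k
        fuel-c = begin-equality
          height ∸ depth c           ≡⟨ cong (height ∸_) (proj₁ c-child) ⟩
          height ∸ suc (depth x)     ≡⟨ suc-injective (trans (sym (∸≡suc∸suc (depth<height x))) fuel≡1+k) ⟩
          k                          ∎

  region-weight≤m : ∀ {x} → ¬ Cut x →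
    ∀ {Q : Fin N → Set} (Q? : Decidable Q) → (∀ y → Q y → ClimbsTo y x) →
    ∑[ y < N ] (𝟙 (Q? y) * weight y) ≤ m
  region-weight≤m ¬cut Q? Q⇒climbs = ≤-trans (region-weight≤residual _ Q? Q⇒climbs) (≮⇒≥ ¬cut)

-- Separators of graphs of bounded treewidth

fibreSize : ∀ {a b} → (Fin a → Fin b) → Fin b → ℕ
fibreSize {a} h y = ∑[ v < a ] 𝟙 (y ≟ᶠ h v)

∑-fibres : ∀ {a b} (h : Fin a → Fin b) (f : Fin b → ℕ) →
  ∑[ v < a ] f (h v) ≡ ∑[ y < b ] (f y * fibreSize h y)
∑-fibres {a} {b} h f = begin
  ∑[ v < a ] f (h v)                              ≡⟨ sum-cong-≗ (λ v → sum-𝟙-≟ (h v) f) ⟨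
  ∑[ v < a ] ∑[ y < b ] (𝟙 (y ≟ᶠ h v) * f y)     ≡⟨ ∑-comm (λ v y → 𝟙 (y ≟ᶠ h v) * f y) ⟩
  ∑[ y < b ] ∑[ v < a ] (𝟙 (y ≟ᶠ h v) * f y)     ≡⟨ sum-cong-≗ (λ y → *-distribʳ-sum (f y) (λ v → 𝟙 (y ≟ᶠ h v))) ⟨
  ∑[ y < b ] (fibreSize h y * f y)                 ≡⟨ sum-cong-≗ (λ y → *-comm (fibreSize h y) (f y)) ⟩
  ∑[ y < b ] (f y * fibreSize h y)                 ∎
  where open ≡-Reasoning

sum-fibreSize : ∀ {a b} (h : Fin a → Fin b) → sum (fibreSize h) ≡ a
sum-fibreSize {a} {b} h = begin
  sum (fibreSize h)                   ≡⟨ sum-cong-≗ (λ y → *-identityˡ (fibreSize h y)) ⟨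
  ∑[ y < b ] (1 * fibreSize h y)      ≡⟨ ∑-fibres h (λ _ → 1) ⟨
  ∑[ v < a ] 1                        ≡⟨ sum-const a 1 ⟩
  a * 1                               ≡⟨ *-identityʳ a ⟩
  a                                   ∎
  where open ≡-Reasoning

record Separator (H : Graph) (t m : ℕ) : Set₁ where
  field
    X  : Fin (n H) → Set
    X? : Decidable X
    size : suc m * count X? ≤ suc t * n H
    small-components : ∀ {u} → ¬ X u → ∀ {Q : Fin (n H) → Set} (Q? : Decidable Q) →
      (∀ v → Q v → Walk H (¬_ ∘ X) u v) → count Q? ≤ m

separator : ∀ {H t} → TreeDecomposition H t → ∀ m → Separator H t m
separator {H} {t} D m = record { X = X ; X? = X? ; size = size ; small-components = small-components }
  where
  open TreeDecomposition D
  -- Each vertex is charged to one bag containing it; a node weighs as many vertices as are charged to it.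
  home : Fin (n H) → Fin (n T)
  home v = proj₁ (vertexCovered v)
  open GreedyCut (rooting T isTree) (fibreSize home) m

  X : Fin (n H) → Set
  X v = ∃[ z ] (Cut z × v ∈ˢ bag z)

  X? : Decidable X
  X? v = any? (λ z → cut? z ×-dec (v ∈? bag z))

  count-X : count X? ≤ suc t * count cut?
  count-X = begin
    ∑[ v < n H ] 𝟙 (X? v)
      ≤⟨ sum-mono-≤ (λ v → 𝟙-any≤sum (λ z → cut? z ×-dec (v ∈? bag z))) ⟩
    ∑[ v < n H ] ∑[ z < n T ] 𝟙 (cut? z ×-dec (v ∈? bag z))
      ≡⟨ ∑-comm (λ v z → 𝟙 (cut? z ×-dec (v ∈? bag z))) ⟩
    ∑[ z < n T ] ∑[ v < n H ] 𝟙 (cut? z ×-dec (v ∈? bag z))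
      ≡⟨ sum-cong-≗ (λ z → bag-count z) ⟩
    ∑[ z < n T ] (𝟙 (cut? z) * ∣ bag z ∣)
      ≤⟨ sum-mono-≤ (λ z → *-monoʳ-≤ (𝟙 (cut? z)) (width z)) ⟩
    ∑[ z < n T ] (𝟙 (cut? z) * suc t)
      ≡⟨ trans (sum-cong-≗ λ z → *-comm (𝟙 (cut? z)) (suc t))
               (sym (*-distribˡ-sum (suc t) (λ z → 𝟙 (cut? z)))) ⟩
    suc t * count cut? ∎
    where
    open ≤-Reasoning
    bag-count : ∀ z → ∑[ v < n H ] 𝟙 (cut? z ×-dec (v ∈? bag z)) ≡ 𝟙 (cut? z) * ∣ bag z ∣
    bag-count z = begin-equality
      ∑[ v < n H ] 𝟙 (cut? z ×-dec (v ∈? bag z))    ≡⟨ sum-cong-≗ (λ v → 𝟙-× (cut? z) (v ∈? bag z)) ⟩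
      ∑[ v < n H ] (𝟙 (cut? z) * 𝟙 (v ∈? bag z))    ≡⟨ *-distribˡ-sum (𝟙 (cut? z)) (λ v → 𝟙 (v ∈? bag z)) ⟨
      𝟙 (cut? z) * count (_∈? bag z)                  ≡⟨ cong (𝟙 (cut? z) *_) (∣p∣≡count (bag z)) ⟨
      𝟙 (cut? z) * ∣ bag z ∣                          ∎

  size : suc m * count X? ≤ suc t * n H
  size = begin
    suc m * count X?              ≤⟨ *-monoʳ-≤ (suc m) count-X ⟩
    suc m * (suc t * count cut?)  ≡⟨ x∙yz≈y∙xz (suc m) (suc t) (count cut?) ⟩
    suc t * (suc m * count cut?)  ≤⟨ *-monoʳ-≤ (suc t) cut-count ⟩
    suc t * sum (fibreSize home)  ≡⟨ cong (suc t *_) (sum-fibreSize home) ⟩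
    suc t * n H                   ∎
    where open ≤-Reasoning

  uncut-home : ∀ {v} → ¬ X v → ¬ Cut (home v)
  uncut-home {v} ¬Xv cut = ¬Xv (home v , cut , proj₂ (vertexCovered v))

  uncut-path-to-bag : ∀ {v z} → ¬ X v → v ∈ˢ bag z → Walk T (¬_ ∘ Cut) (home v) z
  uncut-path-to-bag {v} {z} ¬Xv v∈z =
    weakenʷ (λ v∈y cut → ¬Xv (_ , cut , v∈y)) (subtree v (home v) z (proj₂ (vertexCovered v)) v∈z)

  top-home-walk : ∀ {u v} → Walk H (¬_ ∘ X) u v → top (home u) ≡ top (home v)
  top-home-walk [ _ ]            = refl
  top-home-walk (¬Xu ∷⟨ uv ⟩ w) with edgeCovered _ _ uv
  ... | z , u∈z , v∈z = trans (top-walk (uncut-path-to-bag ¬Xu u∈z))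
                        (trans (sym (top-walk (uncut-path-to-bag (startsIn w) v∈z))) (top-home-walk w))

  small-components : ∀ {u} → ¬ X u → ∀ {Q : Fin (n H) → Set} (Q? : Decidable Q) →
    (∀ v → Q v → Walk H (¬_ ∘ X) u v) → count Q? ≤ m
  small-components {u} ¬Xu {Q} Q? walks = begin
    ∑[ v < n H ] 𝟙 (Q? v)
      ≤⟨ sum-mono-≤ (λ v → 𝟙-mono (Q? v) (hit? (home v)) (λ q → v , q , refl)) ⟩
    ∑[ v < n H ] 𝟙 (hit? (home v))
      ≡⟨ ∑-fibres home (λ y → 𝟙 (hit? y)) ⟩
    ∑[ y < n T ] (𝟙 (hit? y) * fibreSize home y)
      ≤⟨ region-weight≤m (proj₂ (climbs-to-top (uncut-home ¬Xu))) hit? hit⇒climbs ⟩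
    m ∎
    where
    open ≤-Reasoning
    Hit : Fin (n T) → Set
    Hit y = ∃[ v ] (Q v × home v ≡ y)
    hit? : Decidable Hit
    hit? y = any? (λ v → Q? v ×-dec (home v ≟ᶠ y))
    hit⇒climbs : ∀ y → Hit y → ClimbsTo y (top (home u))
    hit⇒climbs _ (v , q , refl) = subst (ClimbsTo (home v)) (sym (top-home-walk (walks v q)))
      (proj₁ (climbs-to-top (uncut-home (endsIn (walks v q)))))

-- Strong products

module Grid (a b : ℕ) where

  row : Fin (a * b) → Fin a
  row i = proj₁ (remQuot {a} b i)

  column : Fin (a * b) → Fin b
  column i = proj₂ (remQuot {a} b i)

  module _ {P : Fin a → Set} {Q : Fin b → Set} (P? : Decidable P) (Q? : Decidable Q) where

    count-⊎-grid : count (λ i → P? (row i) ⊎-dec Q? (column i)) ≤ b * count P? + a * count Q?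
    count-⊎-grid = begin
      ∑[ i < a * b ] 𝟙 (P? (row i) ⊎-dec Q? (column i))
        ≤⟨ sum-mono-≤ (λ i → 𝟙-⊎ (P? (row i)) (Q? (column i))) ⟩
      ∑[ i < a * b ] (𝟙 (P? (row i)) + 𝟙 (Q? (column i)))
        ≡⟨ ∑-distrib-+ (λ i → 𝟙 (P? (row i))) (λ i → 𝟙 (Q? (column i))) ⟩
      ∑[ i < a * b ] 𝟙 (P? (row i)) + ∑[ i < a * b ] 𝟙 (Q? (column i))
        ≡⟨ cong₂ _+_ (∑-remQuot a b (λ (x , _) → 𝟙 (P? x))) (∑-remQuot a b (λ (_ , y) → 𝟙 (Q? y))) ⟩
      ∑[ x < a ] ∑[ y < b ] 𝟙 (P? x) + ∑[ x < a ] ∑[ y < b ] 𝟙 (Q? y)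
        ≡⟨ cong₂ _+_ (trans (sum-cong-≗ {a} λ x → trans (sum-const b (𝟙 (P? x))) (*-comm b (𝟙 (P? x))))
                            (sym (*-distribʳ-sum b (λ x → 𝟙 (P? x)))))
                     (sum-const a (count Q?)) ⟩
      count P? * b + a * count Q?
        ≡⟨ cong (_+ a * count Q?) (*-comm (count P?) b) ⟩
      b * count P? + a * count Q? ∎
      where open ≤-Reasoning

    count-×-grid : ∀ {S : Fin (a * b) → Set} (S? : Decidable S) → (∀ i → S i → P (row i) × Q (column i)) →
      count S? ≤ count P? * count Q?
    count-×-grid S? S⇒P×Q = begin
      ∑[ i < a * b ] 𝟙 (S? i)
        ≤⟨ sum-mono-≤ (λ i → 𝟙-mono (S? i) (P? (row i) ×-dec Q? (column i)) (S⇒P×Q i)) ⟩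
      ∑[ i < a * b ] 𝟙 (P? (row i) ×-dec Q? (column i))
        ≡⟨ ∑-remQuot a b (λ (x , y) → 𝟙 (P? x ×-dec Q? y)) ⟩
      ∑[ x < a ] ∑[ y < b ] 𝟙 (P? x ×-dec Q? y)
        ≡⟨ sum-cong-≗ (λ x → trans (sum-cong-≗ λ y → 𝟙-× (P? x) (Q? y))
                                   (sym (*-distribˡ-sum (𝟙 (P? x)) (λ y → 𝟙 (Q? y))))) ⟩
      ∑[ x < a ] (𝟙 (P? x) * count Q?)
        ≡⟨ sym (*-distribʳ-sum (count Q?) (λ x → 𝟙 (P? x))) ⟩
      count P? * count Q? ∎
      where open ≤-Reasoning

module _ {G H : Graph} where

  open Grid (n G) (n H)

  project₁ : ∀ {P₁ : Fin (n G) → Set} {P : Fin (n (G ⊠ H)) → Set} {i j} →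
    (∀ {k} → P k → P₁ (row k)) → Walk (G ⊠ H) P i j → Walk G P₁ (row i) (row j)
  project₁ P⇒P₁ [ pi ]                               = [ P⇒P₁ pi ]
  project₁ P⇒P₁ (pi ∷⟨ inj₁ (same , _) ⟩ w)          = subst (λ x → Walk G _ x _) (sym same) (project₁ P⇒P₁ w)
  project₁ P⇒P₁ (pi ∷⟨ inj₂ (inj₁ (_ , e)) ⟩ w)      = P⇒P₁ pi ∷⟨ e ⟩ project₁ P⇒P₁ w
  project₁ P⇒P₁ (pi ∷⟨ inj₂ (inj₂ (e , _)) ⟩ w)      = P⇒P₁ pi ∷⟨ e ⟩ project₁ P⇒P₁ w

  project₂ : ∀ {P₂ : Fin (n H) → Set} {P : Fin (n (G ⊠ H)) → Set} {i j} →
    (∀ {k} → P k → P₂ (column k)) → Walk (G ⊠ H) P i j → Walk H P₂ (column i) (column j)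
  project₂ P⇒P₂ [ pi ]                               = [ P⇒P₂ pi ]
  project₂ P⇒P₂ (pi ∷⟨ inj₁ (_ , e) ⟩ w)             = P⇒P₂ pi ∷⟨ e ⟩ project₂ P⇒P₂ w
  project₂ P⇒P₂ (pi ∷⟨ inj₂ (inj₁ (same , _)) ⟩ w)   = subst (λ x → Walk H _ x _) (sym same) (project₂ P⇒P₂ w)
  project₂ P⇒P₂ (pi ∷⟨ inj₂ (inj₂ (_ , e)) ⟩ w)      = P⇒P₂ pi ∷⟨ e ⟩ project₂ P⇒P₂ w

colourOf : ∀ {P : Set} → Dec P → Fin 2
colourOf (yes _) = zero
colourOf (no _)  = suc zero

colourOf-reflects : ∀ {P Q : Set} (d : Dec P) (e : Dec Q) → colourOf d ≡ colourOf e → (Q → P) × (¬ Q → ¬ P)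
colourOf-reflects (yes p) (yes q) _  = (λ _ → p) , (λ ¬q → ⊥-elim (¬q q))
colourOf-reflects (yes _) (no _)  ()
colourOf-reflects (no _)  (yes _) ()
colourOf-reflects (no ¬p) (no ¬q) _  = (λ q → ⊥-elim (¬q q)) , (λ _ → ¬p)

module ProductColouring {H₁ H₂ : Graph} {t m : ℕ} (S₁ : Separator H₁ t m) (S₂ : Separator H₂ t m) where

  open Grid (n H₁) (n H₂)
  module S₁ = Separator S₁
  module S₂ = Separator S₂

  G : Graph
  G = H₁ ⊠ H₂

  OnSeparator : Fin (n G) → Set
  OnSeparator i = S₁.X (row i) ⊎ S₂.X (column i)

  onSeparator? : Decidable OnSeparator
  onSeparator? i = S₁.X? (row i) ⊎-dec S₂.X? (column i)

  colour : Colouring G 2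
  colour i = colourOf (onSeparator? i)

  on-separator-component : ∀ S → InOneMonoComponent G colour S → ∀ {s} → s ∈ˢ S → OnSeparator s →
    suc m * ∣ S ∣ ≤ 2 * (suc t * n G)
  on-separator-component S mono {s} s∈S on-s = begin
    suc m * ∣ S ∣
      ≡⟨ cong (suc m *_) (∣p∣≡count S) ⟩
    suc m * count (_∈? S)
      ≤⟨ *-monoʳ-≤ (suc m) (count-mono (_∈? S) onSeparator? on-separator) ⟩
    suc m * count onSeparator?
      ≤⟨ *-monoʳ-≤ (suc m) (count-⊎-grid S₁.X? S₂.X?) ⟩
    suc m * (n H₂ * count S₁.X? + n H₁ * count S₂.X?)
      ≡⟨ *-distribˡ-+ (suc m) (n H₂ * count S₁.X?) (n H₁ * count S₂.X?) ⟩
    suc m * (n H₂ * count S₁.X?) + suc m * (n H₁ * count S₂.X?)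
      ≡⟨ cong₂ _+_ (x∙yz≈y∙xz (suc m) (n H₂) _) (x∙yz≈y∙xz (suc m) (n H₁) _) ⟩
    n H₂ * (suc m * count S₁.X?) + n H₁ * (suc m * count S₂.X?)
      ≤⟨ +-mono-≤ (*-monoʳ-≤ (n H₂) S₁.size) (*-monoʳ-≤ (n H₁) S₂.size) ⟩
    n H₂ * (suc t * n H₁) + n H₁ * (suc t * n H₂)
      ≡⟨ both-halves (suc t) (n H₁) (n H₂) ⟩
    2 * (suc t * (n H₁ * n H₂)) ∎
    where
    open ≤-Reasoning
    both-halves : ∀ a x y → y * (a * x) + x * (a * y) ≡ 2 * (a * (x * y))
    both-halves = solve 3 (λ a x y → y :* (a :* x) :+ x :* (a :* y) := con 2 :* (a :* (x :* y))) refl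
    on-separator : ∀ i → i ∈ˢ S → OnSeparator i
    on-separator i i∈S =
      proj₁ (colourOf-reflects (onSeparator? i) (onSeparator? s) (endsIn (mono s i s∈S i∈S))) on-s

  off-separator-component : ∀ S → InOneMonoComponent G colour S → ∀ {s} → s ∈ˢ S → ¬ OnSeparator s →
    ∣ S ∣ ≤ m * m
  off-separator-component S mono {s} s∈S off-s = begin
    ∣ S ∣                         ≡⟨ ∣p∣≡count S ⟩
    count (_∈? S)                 ≤⟨ count-×-grid Rows? Columns? (_∈? S) (λ i i∈S → (i , i∈S , refl) , (i , i∈S , refl)) ⟩
    count Rows? * count Columns?  ≤⟨ *-mono-≤ rows≤m columns≤m ⟩
    m * m                         ∎
    where
    open ≤-Reasoning
    Rows : Fin (n H₁) → Set
    Rows a = ∃[ i ] (i ∈ˢ S × row i ≡ a)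
    Rows? : Decidable Rows
    Rows? a = any? (λ i → (i ∈? S) ×-dec (row i ≟ᶠ a))
    Columns : Fin (n H₂) → Set
    Columns b = ∃[ i ] (i ∈ˢ S × column i ≡ b)
    Columns? : Decidable Columns
    Columns? b = any? (λ i → (i ∈? S) ×-dec (column i ≟ᶠ b))
    off : ∀ {i} → colour i ≡ colour s → ¬ OnSeparator i
    off {i} same = proj₂ (colourOf-reflects (onSeparator? i) (onSeparator? s) same) off-s
    rows≤m : count Rows? ≤ m
    rows≤m = S₁.small-components (off-s ∘ inj₁) Rows?
      λ { _ (i , i∈S , refl) → project₁ (λ same → off same ∘ inj₁) (mono s i s∈S i∈S) }
    columns≤m : count Columns? ≤ m
    columns≤m = S₂.small-components (off-s ∘ inj₂) Columns?
      λ { _ (i , i∈S , refl) → project₂ (λ same → off same ∘ inj₂) (mono s i s∈S i∈S) }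

  component-bound : ∀ S → InOneMonoComponent G colour S →
    suc m * ∣ S ∣ ≤ 2 * (suc t * n G) ⊎ ∣ S ∣ ≤ m * m
  component-bound S mono with nonempty? S
  ... | no empty = inj₂ (subst (_≤ m * m) (sym (trans (cong ∣_∣ (Empty-unique empty)) (∣⊥∣≡0 (n G)))) z≤n)
  ... | yes (s , s∈S) with onSeparator? s
  ...   | yes on-s  = inj₁ (on-separator-component S mono s∈S on-s)
  ...   | no off-s  = inj₂ (off-separator-component S mono s∈S off-s)

-- The cube-root bound

P<[1+P]³ : ∀ P → P < suc P ^ 3
P<[1+P]³ P = <-≤-trans (n<1+n P)
  (subst (_≤ suc P ^ 3) (*-identityʳ (suc P)) (^-monoʳ-≤ (suc P) {1} {3} (s≤s z≤n)))

cube-root : ∀ P → ∃[ m ] (m ^ 3 ≤ P × P < suc m ^ 3)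
cube-root P with least (λ k → P <? k ^ 3) {suc P} (P<[1+P]³ P)
... | zero  , P<0       , _     = ⊥-elim (n≮0 P<0)
... | suc m , P<[1+m]³ , below = m , ≮⇒≥ (below ≤-refl) , P<[1+m]³

s³≤8P²⇐[1+m]s≤2P : ∀ {P m s} → P < suc m ^ 3 → suc m * s ≤ 2 * P → s ^ 3 ≤ 8 * P ^ 2
s³≤8P²⇐[1+m]s≤2P {zero}      {m} {s} _          [1+m]s≤0
  rewrite n≤0⇒n≡0 (≤-trans (m≤m+n s (m * s)) [1+m]s≤0) = z≤n
s³≤8P²⇐[1+m]s≤2P {P@(suc _)} {m} {s} P<[1+m]³ [1+m]s≤2P = *-cancelˡ-≤ P (begin
  P * s ^ 3              ≤⟨ *-monoˡ-≤ (s ^ 3) (<⇒≤ P<[1+m]³) ⟩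
  suc m ^ 3 * s ^ 3      ≡⟨ solve 2 (λ a b → (a :* b) :^ 3 := a :^ 3 :* b :^ 3) refl (suc m) s ⟨
  (suc m * s) ^ 3        ≤⟨ ^-monoˡ-≤ 3 [1+m]s≤2P ⟩
  (2 * P) ^ 3            ≡⟨ solve 1 (λ a → (con 2 :* a) :^ 3 := a :* (con 8 :* a :^ 2)) refl P ⟩
  P * (8 * P ^ 2)        ∎)
  where open ≤-Reasoning

s³≤8P²⇐s≤m² : ∀ {P m s} → m ^ 3 ≤ P → s ≤ m * m → s ^ 3 ≤ 8 * P ^ 2
s³≤8P²⇐s≤m² {P} {m} {s} m³≤P s≤m² = begin
  s ^ 3          ≤⟨ ^-monoˡ-≤ 3 s≤m² ⟩
  (m * m) ^ 3    ≡⟨ solve 1 (λ a → (a :* a) :^ 3 := (a :^ 3) :^ 2) refl m ⟩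
  (m ^ 3) ^ 2    ≤⟨ ^-monoˡ-≤ 2 m³≤P ⟩
  P ^ 2          ≤⟨ m≤n*m (P ^ 2) 8 ⟩
  8 * P ^ 2      ∎
  where open ≤-Reasoning

lemma14 : (t : ℕ) → 1 ≤ t → (H₁ H₂ : Graph) → TreewidthAtMost H₁ t → TreewidthAtMost H₂ t →
  ∃ λ (col : Colouring (H₁ ⊠ H₂) 2) →
    ∀ S → InOneMonoComponent (H₁ ⊠ H₂) col S →
      ∣ S ∣ ^ 3 ≤ 8 * (suc t * n (H₁ ⊠ H₂)) ^ 2
lemma14 t _ H₁ H₂ D₁ D₂ with cube-root (suc t * n (H₁ ⊠ H₂))
... | m , m³≤P , P<[1+m]³ = colour , λ S mono →
  [ s³≤8P²⇐[1+m]s≤2P {m = m} P<[1+m]³ , s³≤8P²⇐s≤m² {m = m} m³≤P ]′ (component-bound S mono)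
  where open ProductColouring (separator D₁ m) (separator D₂ m)
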